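{- Let $(\alpha,\tau,S)$ be a homotopy data with $S\cap(\alpha\times\{b\}\times\{b\})\neq\emptyset$ for all $b\in\alpha$. Let $(\mathcal{A},xAByABz)$ be a nanoword over $\alpha$ where $A,B\in\mathcal{A}$ with $|B|=\tau(|A|)$ and $x,y,z$ are words in the alphabet $\mathcal{A}\setminus\{A,B\}$. Then $(\mathcal{A},xAByABz)\simeq_S(\mathcal{A}\setminus\{A,B\},xyz)$.
   Context: A homotopy data consists of a set $\alpha$, an involution $\tau:\alpha\to\alpha$ and a subset $S\subset\alpha\times\alpha\times\alpha$. An $\alpha$-alphabet is a set $\mathcal{A}$ with a map $A\mapsto|A|\in\alpha$. A nanoword over $\alpha$ is a pair $(\mathcal{A},w)$ with $\mathcal{A}$ a finite $\alpha$-alphabet and $w$ a word in $\mathcal{A}$ in which each letter occurs exactly twice. $S$-homotopy $\simeq_S$ is the equivalence relation on nanowords generated by isomorphisms (bijections of alphabets preserving $|\cdot|$ carrying one word letterwise to the other) and the following moves and their inverses ($x,y,z,t$ words in the remaining letters; removed letters are deleted from the alphabet, and new letters in inverse moves may have any projections satisfying the stated conditions): (1) $(\mathcal{A},xAAy)\mapsto(\mathcal{A}\setminus\{A\},xy)$; (2) $(\mathcal{A},xAByBAz)\mapsto(\mathcal{A}\setminus\{A,B\},xyz)$ if $|B|=\tau(|A|)$; (3) $(\mathcal{A},xAByACzBCt)\mapsto(\mathcal{A},xBAyCAzCBt)$ if $A,B,C$ are distinct and $(|A|,|B|,|C|)\in S$. -}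

module Defs where

open import Data.Nat using (ℕ; suc)
open import Data.Fin using (Fin; _≟_)
open import Data.List using (List; []; _∷_; _++_; map; filter; length)
open import Data.Product using (Σ; ∃; _×_)
open import Relation.Binary.PropositionalEquality using (_≡_; _≢_)
open import Relation.Binary.Construct.Closure.Equivalence using (EqClosure)
open import Function.Bundles using (_↔_; Inverse)
open import Function.Definitions using (Injective)

record HomotopyData : Set₁ where
  field
    α   : Set
    τ   : α → α
    τ-involutive : ∀ a → τ (τ a) ≡ a
    S   : α → α → α → Set

occ : {n : ℕ} → Fin n → List (Fin n) → ℕ
occ i w = length (filter (i ≟_) w)

-- The finite α-alphabet is represented (up to
-- isomorphism of α-alphabets) as Fin size together with the projection
-- proj : Fin size → α ; every letter of the alphabet occurs exactly twice.
record Nanoword (α : Set) : Set where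
  constructor nanoword
  field
    size  : ℕ
    proj  : Fin size → α
    word  : List (Fin size)
    twice : ∀ i → occ i word ≡ 2
open Nanoword public

module _ (H : HomotopyData) where
  open HomotopyData H

  data Step : Nanoword α → Nanoword α → Set where
    iso : ∀ w w' (σ : Fin (size w) ↔ Fin (size w')) →
          (∀ i → proj w' (Inverse.to σ i) ≡ proj w i) →
          map (Inverse.to σ) (word w) ≡ word w' →
          Step w w'
    -- move (1): (A, xAAy) ↦ (A ∖ {A}, xy).  The alphabet of w' is
    -- identified with A ∖ {A} via a |.|-preserving injection e
    -- whose image misses A (and has one element fewer).
    move1 : ∀ w w' (A : Fin (size w)) (x y : List (Fin (size w)))
            (e : Fin (size w') → Fin (size w)) →
            Injective _≡_ _≡_ e →
            (∀ j → proj w (e j) ≡ proj w' j) →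
            (∀ j → e j ≢ A) →
            size w ≡ suc (size w') →
            word w ≡ x ++ A ∷ A ∷ y →
            map e (word w') ≡ x ++ y →
            Step w w'
    move2 : ∀ w w' (A B : Fin (size w)) (x y z : List (Fin (size w)))
            (e : Fin (size w') → Fin (size w)) →
            A ≢ B →
            proj w B ≡ τ (proj w A) →
            Injective _≡_ _≡_ e →
            (∀ j → proj w (e j) ≡ proj w' j) →
            (∀ j → e j ≢ A) →
            (∀ j → e j ≢ B) →
            size w ≡ suc (suc (size w')) →
            word w ≡ x ++ A ∷ B ∷ y ++ B ∷ A ∷ z →
            map e (word w') ≡ x ++ y ++ z →
            Step w w'
    move3 : ∀ (n : ℕ) (p : Fin n → α) (A B C : Fin n)
            (x y z t : List (Fin n)) tw tw' →
            A ≢ B → B ≢ C → A ≢ C →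
            S (p A) (p B) (p C) →
            Step (nanoword n p (x ++ A ∷ B ∷ y ++ A ∷ C ∷ z ++ B ∷ C ∷ t) tw)
                 (nanoword n p (x ++ B ∷ A ∷ y ++ C ∷ A ∷ z ++ C ∷ B ∷ t) tw')

  _≃S_ : Nanoword α → Nanoword α → Set
  _≃S_ = EqClosure Step

{-# OPTIONS --safe #-}
module Submission where

-- Pick c with (c, |B|, |B|) ∈ S and fresh letters C, D, E, F with |C| = c, |D| = τ c,
-- |E| = |A|, |F| = |B|.  Then
--   xAByABz ← xDCABCDyABz ← xDEFCABCDyABFEz ← xDECFACBDyAFBEz
--           → xDECCBDyBEz → xDEBDyBEz → xDDyz → xyz
-- by moves (2), (2), (3), (2), (1), (2), (1); the blocks x, y, z are never touched.
-- Formally, every word of the chain is a template: k fresh letters, numbered first, interleaved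
-- with blocks of letters of w'.  The given word is isomorphic to such a template once A, B are
-- renamed 0, 1 and e becomes the shift by 2, because an injective self-map of Fin is bijective.

open import Defs
open import Data.Nat using (ℕ; suc; _+_)
import Data.Nat.Properties as ℕ
open import Data.Fin using (Fin; zero; suc; _≟_; _↑ˡ_; _↑ʳ_; punchIn; punchOut; splitAt; join)
open import Data.Fin.Properties
  using (suc-injective; ↑ˡ-injective; ↑ʳ-injective; punchIn-injective; punchInᵢ≢i;
         punchOut-injective; <⇒notInjective; any?; all?; join-splitAt)
open import Data.Fin.Patterns using (0F; 1F; 2F; 3F; 4F; 5F)
open import Data.List using (List; []; _∷_; _++_; [_]; map; filter; length)
open import Data.List.Properties
  using (map-++; map-∘; map-id; map-cong; ++-assoc; ++-identityʳ; ∷-injective; filter-++; length-++)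
open import Data.Vec using (Vec; []; _∷_; lookup; removeAt)
import Data.Vec as Vec
open import Data.Product using (∃; ∃₂; _×_; _,_; proj₂)
open import Data.Empty using (⊥-elim)
open import Data.Sum using (inj₁; inj₂)
open import Function using (_∘_; id; _↔_)
open import Function.Definitions using (Injective; StrictlySurjective)
open import Function.Consequences.Propositional using (strictlySurjective⇒surjective)
open import Function.Bundles using (mk⤖)
open import Function.Properties.Bijection using (⤖⇒↔)
open import Relation.Nullary using (Dec; yes; no; contradiction)
open import Relation.Nullary.Decidable using (True; toWitness)
open import Relation.Binary.PropositionalEquality
  using (_≡_; _≢_; refl; sym; trans; cong; cong₂; subst; subst₂; module ≡-Reasoning)
open import Relation.Binary.Construct.Closure.Equivalence using (return; setoid)
open import Relation.Binary.Construct.Closure.ReflexiveTransitive using (_◅◅_)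
import Relation.Binary.Reasoning.Setoid as SetoidReasoning

injective⇒strictlySurjective : ∀ {n} {f : Fin n → Fin n} →
  Injective _≡_ _≡_ f → StrictlySurjective _≡_ f
injective⇒strictlySurjective {suc n} {f} f-inj i with any? (λ j → f j ≟ i)
... | yes hit  = hit
... | no  miss = ⊥-elim (<⇒notInjective (ℕ.n<1+n n) g-injective)
  where
  i≢f : ∀ j → i ≢ f j
  i≢f j i≡fj = miss (j , sym i≡fj)

  g : Fin (suc n) → Fin n
  g j = punchOut (i≢f j)

  g-injective : Injective _≡_ _≡_ g
  g-injective {j} {j′} eq = f-inj (punchOut-injective (i≢f j) (i≢f j′) eq)

injective⇒↔ : ∀ {n} (f : Fin n → Fin n) → Injective _≡_ _≡_ f → Fin n ↔ Fin n
injective⇒↔ f f-inj =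
  ⤖⇒↔ (mk⤖ (f-inj , strictlySurjective⇒surjective (injective⇒strictlySurjective f-inj)))

map-++⁻ : ∀ {A B : Set} (f : A → B) (l : List A) (u v : List B) → map f l ≡ u ++ v →
          ∃₂ λ l₁ l₂ → l ≡ l₁ ++ l₂ × map f l₁ ≡ u × map f l₂ ≡ v
map-++⁻ f l       []      v eq = [] , l , refl , refl , eq
map-++⁻ f []      (b ∷ u) v ()
map-++⁻ f (a ∷ l) (b ∷ u) v eq with ∷-injective eq
... | fa≡b , rest with map-++⁻ f l u v rest
...   | l₁ , l₂ , refl , refl , refl = a ∷ l₁ , l₂ , refl , cong (_∷ _) fa≡b , refl

map-++-++⁻ : ∀ {A B : Set} (f : A → B) (l : List A) (u v w : List B) → map f l ≡ u ++ v ++ w →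
             ∃ λ l₁ → ∃₂ λ l₂ l₃ →
             l ≡ l₁ ++ l₂ ++ l₃ × map f l₁ ≡ u × map f l₂ ≡ v × map f l₃ ≡ w
map-++-++⁻ f l u v w eq with map-++⁻ f l u (v ++ w) eq
... | l₁ , l₂₃ , refl , refl , eq₂₃ with map-++⁻ f l₂₃ v w eq₂₃
...   | l₂ , l₃ , refl , refl , refl = l₁ , l₂ , l₃ , refl , refl , refl , refl

Gauss : ∀ {m} → List (Fin m) → Set
Gauss w = ∀ i → occ i w ≡ 2

gauss? : ∀ {m} (w : List (Fin m)) → Dec (Gauss w)
gauss? w = all? (λ i → occ i w ℕ.≟ 2)

module _ {m : ℕ} where

  occ-++ : ∀ (i : Fin m) u v → occ i (u ++ v) ≡ occ i u + occ i v
  occ-++ i u v = trans (cong length (filter-++ (i ≟_) u v)) (length-++ (filter (i ≟_) u))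

  occ-∷-≢ : ∀ {i a : Fin m} u → i ≢ a → occ i (a ∷ u) ≡ occ i u
  occ-∷-≢ {i} {a} u i≢a with i ≟ a
  ... | yes i≡a = contradiction i≡a i≢a
  ... | no  _   = refl

  module _ {m′ : ℕ} {f : Fin m′ → Fin m} (f-inj : Injective _≡_ _≡_ f) where

    occ-∷-injective : ∀ j a {u v} → occ (f j) u ≡ occ j v → occ (f j) (f a ∷ u) ≡ occ j (a ∷ v)
    occ-∷-injective j a eq with f j ≟ f a | j ≟ a
    ... | yes _     | yes _   = cong suc eq
    ... | no  _     | no  _   = eq
    ... | yes fj≡fa | no j≢a  = contradiction (f-inj fj≡fa) j≢a
    ... | no fj≢fa  | yes j≡a = contradiction (cong f j≡a) fj≢fa

    occ-map : ∀ j u → occ (f j) (map f u) ≡ occ j u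
    occ-map j []      = refl
    occ-map j (a ∷ u) = occ-∷-injective j a (occ-map j u)

  occ-map-∌ : ∀ {m′} {f : Fin m′ → Fin m} {i} → (∀ a → i ≢ f a) → ∀ u → occ i (map f u) ≡ 0
  occ-map-∌ i∉f []      = refl
  occ-map-∌ i∉f (a ∷ u) = trans (occ-∷-≢ _ (i∉f a)) (occ-map-∌ i∉f u)

↑ˡ≢↑ʳ : ∀ {k n} (a : Fin k) (j : Fin n) → a ↑ˡ n ≢ k ↑ʳ j
↑ˡ≢↑ʳ zero    j ()
↑ˡ≢↑ʳ (suc a) j eq = ↑ˡ≢↑ʳ a j (suc-injective eq)

punchIn-↑ˡ : ∀ {k} n (A : Fin (suc k)) (a : Fin k) → punchIn (A ↑ˡ n) (a ↑ˡ n) ≡ punchIn A a ↑ˡ n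
punchIn-↑ˡ n zero    a       = refl
punchIn-↑ˡ n (suc A) zero    = refl
punchIn-↑ˡ n (suc A) (suc a) = cong suc (punchIn-↑ˡ n A a)

punchIn-↑ʳ : ∀ {k n} (A : Fin (suc k)) (j : Fin n) → punchIn (A ↑ˡ n) (k ↑ʳ j) ≡ suc k ↑ʳ j
punchIn-↑ʳ         zero    j = refl
punchIn-↑ʳ {suc k} (suc A) j = cong suc (punchIn-↑ʳ A j)

data Piece (k n : ℕ) : Set where
  new : Fin k → Piece k n
  old : List (Fin n) → Piece k n

Template : ℕ → ℕ → Set
Template k n = List (Piece k n)

module _ {k n : ℕ} where

  module _ {X : Set} (ν : Fin k → X) (ι : Fin n → X) where

    expand : Template k n → List X
    expand []          = []
    expand (new a ∷ t) = ν a ∷ expand t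
    expand (old b ∷ t) = map ι b ++ expand t

    expand-++ : ∀ t t′ → expand (t ++ t′) ≡ expand t ++ expand t′
    expand-++ []          t′ = refl
    expand-++ (new a ∷ t) t′ = cong (ν a ∷_) (expand-++ t t′)
    expand-++ (old b ∷ t) t′ =
      trans (cong (map ι b ++_) (expand-++ t t′)) (sym (++-assoc (map ι b) _ _))

  map-expand : ∀ {X Y : Set} (f : X → Y) (ν : Fin k → X) (ι : Fin n → X) t →
               map f (expand ν ι t) ≡ expand (f ∘ ν) (f ∘ ι) t
  map-expand f ν ι []          = refl
  map-expand f ν ι (new a ∷ t) = cong (f (ν a) ∷_) (map-expand f ν ι t)
  map-expand f ν ι (old b ∷ t) =
    trans (map-++ f (map ι b) _) (cong₂ _++_ (sym (map-∘ b)) (map-expand f ν ι t))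

  fill : Template k n → List (Fin (k + n))
  fill = expand (_↑ˡ n) (k ↑ʳ_)

  fill-++ : ∀ t t′ → fill (t ++ t′) ≡ fill t ++ fill t′
  fill-++ = expand-++ _ _

  newLetters : Template k n → List (Fin k)
  newLetters []          = []
  newLetters (new a ∷ t) = a ∷ newLetters t
  newLetters (old _ ∷ t) = newLetters t

  oldLetters : Template k n → List (Fin n)
  oldLetters []          = []
  oldLetters (new _ ∷ t) = oldLetters t
  oldLetters (old b ∷ t) = b ++ oldLetters t

  occ-fill-new : ∀ a t → occ (a ↑ˡ n) (fill t) ≡ occ a (newLetters t)
  occ-fill-new a []          = refl
  occ-fill-new a (new b ∷ t) = occ-∷-injective (↑ˡ-injective n _ _) a b (occ-fill-new a t)
  occ-fill-new a (old b ∷ t) =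
    trans (occ-++ _ (map (k ↑ʳ_) b) (fill t))
          (cong₂ _+_ (occ-map-∌ (↑ˡ≢↑ʳ a) b) (occ-fill-new a t))

  occ-fill-old : ∀ j t → occ (k ↑ʳ j) (fill t) ≡ occ j (oldLetters t)
  occ-fill-old j []          = refl
  occ-fill-old j (new b ∷ t) = trans (occ-∷-≢ _ (↑ˡ≢↑ʳ b j ∘ sym)) (occ-fill-old j t)
  occ-fill-old j (old b ∷ t) =
    trans (occ-++ _ (map (k ↑ʳ_) b) (fill t))
          (trans (cong₂ _+_ (occ-map (↑ʳ-injective k _ _) j b) (occ-fill-old j t))
                 (sym (occ-++ j b (oldLetters t))))

  fill-gauss : ∀ t → Gauss (newLetters t) → Gauss (oldLetters t) → Gauss (fill t)
  fill-gauss t new-gauss old-gauss i =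
    subst (λ i → occ i (fill t) ≡ 2) (join-splitAt k n i) (by-side (splitAt k i))
    where
    by-side : ∀ s → occ (join k n s) (fill t) ≡ 2
    by-side (inj₁ a) = trans (occ-fill-new a t) (new-gauss a)
    by-side (inj₂ j) = trans (occ-fill-old j t) (old-gauss j)

rename : ∀ {k k′ n} → (Fin k → Fin k′) → Template k n → Template k′ n
rename σ = map λ where
  (new a) → new (σ a)
  (old b) → old b

fill-punchIn : ∀ {k n} (A : Fin (suc k)) (t : Template k n) →
               map (punchIn (A ↑ˡ n)) (fill t) ≡ fill (rename (punchIn A) t)
fill-punchIn {n = n} A [] = refl
fill-punchIn {n = n} A (new a ∷ t) = cong₂ _∷_ (punchIn-↑ˡ n A a) (fill-punchIn A t)
fill-punchIn {k} {n} A (old b ∷ t) =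
  trans (map-++ (punchIn (A ↑ˡ n)) (map (k ↑ʳ_) b) (fill t))
        (cong₂ _++_ (trans (sym (map-∘ b)) (map-cong (punchIn-↑ʳ A) b)) (fill-punchIn A t))

module _ {X : Set} where

  labelling : ∀ {k n} → Vec X k → (Fin n → X) → Fin (k + n) → X
  labelling []       g i       = g i
  labelling (q ∷ qs) g zero    = q
  labelling (q ∷ qs) g (suc i) = labelling qs g i

  labelling-↑ˡ : ∀ {k n} (qs : Vec X k) {g : Fin n → X} a → labelling qs g (a ↑ˡ n) ≡ lookup qs a
  labelling-↑ˡ (q ∷ qs) zero    = refl
  labelling-↑ˡ (q ∷ qs) (suc a) = labelling-↑ˡ qs a

  labelling-removeAt : ∀ {k n} (qs : Vec X (suc k)) {g : Fin n → X} A i →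
                       labelling (removeAt qs A) g i ≡ labelling qs g (punchIn (A ↑ˡ n) i)
  labelling-removeAt (q ∷ qs)      zero    i       = refl
  labelling-removeAt (q ∷ q′ ∷ qs) (suc A) zero    = refl
  labelling-removeAt (q ∷ q′ ∷ qs) (suc A) (suc i) = labelling-removeAt (q′ ∷ qs) A i

  labelling-∷-injective : ∀ {k n} {q : X} {qs : Vec X k} {g : Fin n → X} →
    (∀ i → labelling qs g i ≢ q) → Injective _≡_ _≡_ (labelling qs g) →
    Injective _≡_ _≡_ (labelling (q ∷ qs) g)
  labelling-∷-injective fresh inj {zero}  {zero}  eq = refl
  labelling-∷-injective fresh inj {zero}  {suc j} eq = contradiction (sym eq) (fresh j)
  labelling-∷-injective fresh inj {suc i} {zero}  eq = contradiction eq (fresh i)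
  labelling-∷-injective fresh inj {suc i} {suc j} eq = cong suc (inj eq)

labelling-map : ∀ {X Y : Set} {k n} (f : X → Y) (qs : Vec X k) {g : Fin n → X} {h : Fin n → Y} →
                (∀ j → f (g j) ≡ h j) → ∀ i → f (labelling qs g i) ≡ labelling (Vec.map f qs) h i
labelling-map f []       f∘g≡h i       = f∘g≡h i
labelling-map f (q ∷ qs) f∘g≡h zero    = refl
labelling-map f (q ∷ qs) f∘g≡h (suc i) = labelling-map f qs f∘g≡h i

module Moves (H : HomotopyData) where
  open HomotopyData H

  infix 4 _≃_
  _≃_ : Nanoword α → Nanoword α → Set
  _≃_ = _≃S_ H

  injective-relabel : ∀ {m} {q q′ : Fin m → α} {l l′ g g′} (f : Fin m → Fin m) →
    Injective _≡_ _≡_ f → (∀ i → q′ (f i) ≡ q i) → map f l ≡ l′ →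
    nanoword m q l g ≃ nanoword m q′ l′ g′
  injective-relabel f f-inj q′∘f≡q f[l]≡l′ =
    return (iso _ _ (injective⇒↔ f f-inj) q′∘f≡q f[l]≡l′)

  ≡-word : ∀ {m} {q : Fin m → α} {l l′ g g′} → l ≡ l′ → nanoword m q l g ≃ nanoword m q l′ g′
  ≡-word {l = l} l≡l′ = injective-relabel id id (λ _ → refl) (trans (map-id l) l≡l′)

  module _ {n : ℕ} (p : Fin n → α) where

    templateWord : ∀ {k} → Vec α k → (t : Template k n) → Gauss (fill t) → Nanoword α
    templateWord qs t = nanoword _ (labelling qs p) (fill t)

    fill-++-∷∷ : ∀ {k} (t₁ t₂ : Template k n) a b →
                 fill (t₁ ++ new a ∷ new b ∷ t₂) ≡ fill t₁ ++ (a ↑ˡ n) ∷ (b ↑ˡ n) ∷ fill t₂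
    fill-++-∷∷ t₁ t₂ a b = fill-++ t₁ (new a ∷ new b ∷ t₂)

    module _ {k : ℕ} where

      delete-loop : ∀ (qs : Vec α (suc k)) A (t₁ t₂ : Template (suc k) n) (t : Template k n)
        {g g′} →
        rename (punchIn A) t ≡ t₁ ++ t₂ →
        templateWord qs (t₁ ++ new A ∷ new A ∷ t₂) g ≃ templateWord (removeAt qs A) t g′
      delete-loop qs A t₁ t₂ t t≡t₁t₂ = return (move1 _ _ (A ↑ˡ n) (fill t₁) (fill t₂)
        (punchIn (A ↑ˡ n)) (punchIn-injective (A ↑ˡ n) _ _)
        (λ j → sym (labelling-removeAt qs A j)) (punchInᵢ≢i (A ↑ˡ n)) refl
        (fill-++ t₁ _) map-fill-t)
        where
        open ≡-Reasoning
        map-fill-t : map (punchIn (A ↑ˡ n)) (fill t) ≡ fill t₁ ++ fill t₂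
        map-fill-t = begin
          map (punchIn (A ↑ˡ n)) (fill t) ≡⟨ fill-punchIn A t ⟩
          fill (rename (punchIn A) t)     ≡⟨ cong fill t≡t₁t₂ ⟩
          fill (t₁ ++ t₂)                 ≡⟨ fill-++ t₁ t₂ ⟩
          fill t₁ ++ fill t₂              ∎

      delete-pair : ∀ (qs : Vec α (2 + k)) A B (t₁ t₂ t₃ : Template (2 + k) n) (t : Template k n)
        {g g′} →
        lookup qs (punchIn A B) ≡ τ (lookup qs A) →
        rename (punchIn A) (rename (punchIn B) t) ≡ t₁ ++ t₂ ++ t₃ →
        templateWord qs (t₁ ++ new A ∷ new (punchIn A B) ∷ t₂ ++ new (punchIn A B) ∷ new A ∷ t₃) g
          ≃ templateWord (removeAt (removeAt qs A) B) t g′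
      delete-pair qs A B t₁ t₂ t₃ t |B|≡τ|A| t≡t₁t₂t₃ = return (move2 _ _ A′ B′
        (fill t₁) (fill t₂) (fill t₃) e
        (λ A′≡B′ → punchInᵢ≢i A B (sym (↑ˡ-injective n _ _ A′≡B′)))
        (trans (labelling-↑ˡ qs _) (trans |B|≡τ|A| (cong τ (sym (labelling-↑ˡ qs A)))))
        (λ eq → punchIn-injective (B ↑ˡ n) _ _ (punchIn-injective A′ _ _ eq))
        (λ j → sym (trans (labelling-removeAt (removeAt qs A) B j) (labelling-removeAt qs A _)))
        (λ j → punchInᵢ≢i A′ _)
        (λ j eq → punchInᵢ≢i (B ↑ˡ n) j
                    (punchIn-injective A′ _ _ (trans eq (sym (punchIn-↑ˡ n A B)))))
        refl
        (trans (fill-++-∷∷ t₁ _ A _) (cong (λ l → fill t₁ ++ A′ ∷ B′ ∷ l) (fill-++-∷∷ t₂ t₃ _ A)))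
        map-e-fill-t)
        where
        A′ = A ↑ˡ n
        B′ = punchIn A B ↑ˡ n
        e : Fin (k + n) → Fin (2 + k + n)
        e = punchIn A′ ∘ punchIn (B ↑ˡ n)
        open ≡-Reasoning
        map-e-fill-t : map e (fill t) ≡ fill t₁ ++ fill t₂ ++ fill t₃
        map-e-fill-t = begin
          map e (fill t)                                        ≡⟨ map-∘ (fill t) ⟩
          map (punchIn A′) (map (punchIn (B ↑ˡ n)) (fill t))    ≡⟨ cong (map _) (fill-punchIn B t) ⟩
          map (punchIn A′) (fill (rename (punchIn B) t))        ≡⟨ fill-punchIn A (rename (punchIn B) t) ⟩
          fill (rename (punchIn A) (rename (punchIn B) t))      ≡⟨ cong fill t≡t₁t₂t₃ ⟩
          fill (t₁ ++ t₂ ++ t₃)                                 ≡⟨ fill-++ t₁ _ ⟩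
          fill t₁ ++ fill (t₂ ++ t₃)                            ≡⟨ cong (fill t₁ ++_) (fill-++ t₂ t₃) ⟩
          fill t₁ ++ fill t₂ ++ fill t₃                         ∎

      braid : ∀ (qs : Vec α k) A B C (t₁ t₂ t₃ t₄ : Template k n) {g g′} →
        A ≢ B → B ≢ C → A ≢ C → S (lookup qs A) (lookup qs B) (lookup qs C) →
        templateWord qs (t₁ ++ new A ∷ new B ∷ t₂ ++ new A ∷ new C ∷ t₃ ++ new B ∷ new C ∷ t₄) g
          ≃ templateWord qs (t₁ ++ new B ∷ new A ∷ t₂ ++ new C ∷ new A ∷ t₃ ++ new C ∷ new B ∷ t₄) g′
      braid qs A B C t₁ t₂ t₃ t₄ {g} {g′} A≢B B≢C A≢C s =
        ≡-word (split A B A C B C) ◅◅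
        return (move3 _ _ (A ↑ˡ n) (B ↑ˡ n) (C ↑ˡ n) (fill t₁) (fill t₂) (fill t₃) (fill t₄)
                  (subst Gauss (split A B A C B C) g) (subst Gauss (split B A C A C B) g′)
                  (A≢B ∘ ↑ˡ-injective n _ _) (B≢C ∘ ↑ˡ-injective n _ _) (A≢C ∘ ↑ˡ-injective n _ _)
                  (subst₂ (S _) (sym (labelling-↑ˡ qs B)) (sym (labelling-↑ˡ qs C))
                    (subst (λ a → S a _ _) (sym (labelling-↑ˡ qs A)) s))) ◅◅
        ≡-word (sym (split B A C A C B))
        where
        split : ∀ a b c d e f →
          fill (t₁ ++ new a ∷ new b ∷ t₂ ++ new c ∷ new d ∷ t₃ ++ new e ∷ new f ∷ t₄)
            ≡ fill t₁ ++ (a ↑ˡ n) ∷ (b ↑ˡ n) ∷ fill t₂ ++ (c ↑ˡ n) ∷ (d ↑ˡ n) ∷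
              fill t₃ ++ (e ↑ˡ n) ∷ (f ↑ˡ n) ∷ fill t₄
        split a b c d e f =
          trans (fill-++-∷∷ t₁ _ a b)
                (cong (λ l → fill t₁ ++ (a ↑ˡ n) ∷ (b ↑ˡ n) ∷ l)
                      (trans (fill-++-∷∷ t₂ _ c d)
                             (cong (λ l → fill t₂ ++ (c ↑ˡ n) ∷ (d ↑ˡ n) ∷ l)
                                   (fill-++-∷∷ t₃ t₄ e f))))

    standard-form : ∀ {p₀ : Fin (2 + n) → α} {A B} {e : Fin n → Fin (2 + n)} {x y z g g′} →
      A ≢ B → Injective _≡_ _≡_ e → (∀ j → p₀ (e j) ≡ p j) → (∀ j → e j ≢ A) → (∀ j → e j ≢ B) →
      templateWord (p₀ A ∷ p₀ B ∷ []) (old x ∷ new 0F ∷ new 1F ∷ old y ∷ new 0F ∷ new 1F ∷ old z ∷ []) g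
        ≃ nanoword (2 + n) p₀ (map e x ++ A ∷ B ∷ map e y ++ A ∷ B ∷ map e z) g′
    standard-form {p₀} {A} {B} {e} {x} {y} {z} A≢B e-inj p₀∘e≡p e≢A e≢B =
      injective-relabel σ (labelling-∷-injective σ≢A (labelling-∷-injective e≢B e-inj))
        (labelling-map p₀ (A ∷ B ∷ []) p₀∘e≡p)
        (trans (map-expand σ (_↑ˡ n) (2 ↑ʳ_) t)
               (cong (λ l → map e x ++ A ∷ B ∷ map e y ++ A ∷ B ∷ l) (++-identityʳ (map e z))))
      where
      t : Template 2 n
      t = old x ∷ new 0F ∷ new 1F ∷ old y ∷ new 0F ∷ new 1F ∷ old z ∷ []
      σ : Fin (2 + n) → Fin (2 + n)
      σ = labelling (A ∷ B ∷ []) e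
      σ≢A : ∀ i → labelling (B ∷ []) e i ≢ A
      σ≢A zero    = A≢B ∘ sym
      σ≢A (suc j) = e≢A j

  -- xyz is stated with the trailing [] that oldLetters produces on the templates below.
  module Chain {n} (p : Fin n → α) {a b c : α} (b≡τa : b ≡ τ a) (s : S c b b)
               (x y z : List (Fin n)) (xyz : Gauss (x ++ y ++ z ++ [])) where

    gaussWord : ∀ {k} (qs : Vec α k) (t : Template k n) {_ : True (gauss? (newLetters t))} →
                Gauss (oldLetters t) → Nanoword α
    gaussWord qs t {new-gauss} old-gauss =
      templateWord p qs t (fill-gauss t (toWitness new-gauss) old-gauss)

    q₀ : Vec α 2
    q₀ = a ∷ b ∷ []                   -- A B
    t₀ : Template 2 n
    t₀ = old x ∷ new 0F ∷ new 1F ∷ old y ∷ new 0F ∷ new 1F ∷ old z ∷ []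

    q₁ : Vec α 4
    q₁ = τ c ∷ c ∷ a ∷ b ∷ []         -- D C A B
    t₁ : Template 4 n
    t₁ = old x ∷ new 0F ∷ new 1F ∷ new 2F ∷ new 3F ∷ new 1F ∷ new 0F ∷
         old y ∷ new 2F ∷ new 3F ∷ old z ∷ []

    q₂ : Vec α 6
    q₂ = a ∷ b ∷ τ c ∷ c ∷ a ∷ b ∷ [] -- E F D C A B
    t₂ t₃ : Template 6 n
    t₂ = old x ∷ new 2F ∷ new 0F ∷ new 1F ∷ new 3F ∷ new 4F ∷ new 5F ∷ new 3F ∷ new 2F ∷
         old y ∷ new 4F ∷ new 5F ∷ new 1F ∷ new 0F ∷ old z ∷ []
    t₃ = old x ∷ new 2F ∷ new 0F ∷ new 3F ∷ new 1F ∷ new 4F ∷ new 3F ∷ new 5F ∷ new 2F ∷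
         old y ∷ new 4F ∷ new 1F ∷ new 5F ∷ new 0F ∷ old z ∷ []

    q₄ : Vec α 4
    q₄ = a ∷ τ c ∷ c ∷ b ∷ []         -- E D C B
    t₄ : Template 4 n
    t₄ = old x ∷ new 1F ∷ new 0F ∷ new 2F ∷ new 2F ∷ new 3F ∷ new 1F ∷
         old y ∷ new 3F ∷ new 0F ∷ old z ∷ []

    q₅ : Vec α 3
    q₅ = a ∷ τ c ∷ b ∷ []             -- E D B
    t₅ : Template 3 n
    t₅ = old x ∷ new 1F ∷ new 0F ∷ new 2F ∷ new 1F ∷ old y ∷ new 2F ∷ new 0F ∷ old z ∷ []

    q₆ : Vec α 1
    q₆ = τ c ∷ []                     -- D
    t₆ : Template 1 n
    t₆ = old x ∷ new 0F ∷ new 0F ∷ old y ∷ old z ∷ []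

    t₇ : Template 0 n
    t₇ = old x ∷ old y ∷ old z ∷ []

    W₀ W₁ W₂ W₃ W₄ W₅ W₆ W₇ : Nanoword α
    W₀ = gaussWord q₀ t₀ xyz
    W₁ = gaussWord q₁ t₁ xyz
    W₂ = gaussWord q₂ t₂ xyz
    W₃ = gaussWord q₂ t₃ xyz
    W₄ = gaussWord q₄ t₄ xyz
    W₅ = gaussWord q₅ t₅ xyz
    W₆ = gaussWord q₆ t₆ xyz
    W₇ = gaussWord [] t₇ xyz

    open SetoidReasoning (setoid (Step H))

    W₀≃W₇ : W₀ ≃ W₇
    W₀≃W₇ = begin
      W₀ ≈⟨ delete-pair p q₁ 0F 0F [ old x ] (new 2F ∷ [ new 3F ])
              (old y ∷ new 2F ∷ new 3F ∷ [ old z ]) t₀ (sym (τ-involutive c)) refl ⟨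
      W₁ ≈⟨ delete-pair p q₂ 0F 0F (old x ∷ [ new 2F ])
              (new 3F ∷ new 4F ∷ new 5F ∷ new 3F ∷ new 2F ∷ old y ∷ new 4F ∷ [ new 5F ]) [ old z ] t₁
              b≡τa refl ⟨
      W₂ ≈⟨ braid p q₂ 3F 1F 5F (old x ∷ new 2F ∷ [ new 0F ]) [ new 4F ] (new 2F ∷ old y ∷ [ new 4F ])
              (new 0F ∷ [ old z ]) (λ ()) (λ ()) (λ ()) s ⟨
      W₃ ≈⟨ delete-pair p q₂ 1F 3F (old x ∷ new 2F ∷ new 0F ∷ [ new 3F ])
              (new 3F ∷ new 5F ∷ new 2F ∷ [ old y ]) (new 5F ∷ new 0F ∷ [ old z ]) t₄ a≡τb refl ⟩
      W₄ ≈⟨ delete-loop p q₄ 2F (old x ∷ new 1F ∷ [ new 0F ])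
              (new 3F ∷ new 1F ∷ old y ∷ new 3F ∷ new 0F ∷ [ old z ]) t₅ refl ⟩
      W₅ ≈⟨ delete-pair p q₅ 0F 1F (old x ∷ [ new 1F ]) (new 1F ∷ [ old y ]) [ old z ] t₆ b≡τa refl ⟩
      W₆ ≈⟨ delete-loop p q₆ 0F [ old x ] (old y ∷ [ old z ]) t₇ refl ⟩
      W₇ ∎
      where
      a≡τb : a ≡ τ b
      a≡τb = trans (sym (τ-involutive a)) (cong τ (sym b≡τa))

lemma3p2 : (H : HomotopyData) →
    (∀ b → ∃ λ a → HomotopyData.S H a b b) →
    (w w' : Nanoword (HomotopyData.α H)) (A B : Fin (size w))
    (x y z : List (Fin (size w))) (e : Fin (size w') → Fin (size w)) →
    A ≢ B →
    proj w B ≡ HomotopyData.τ H (proj w A) →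
    Injective _≡_ _≡_ e →
    (∀ j → proj w (e j) ≡ proj w' j) →
    (∀ j → e j ≢ A) →
    (∀ j → e j ≢ B) →
    size w ≡ suc (suc (size w')) →
    word w ≡ x ++ A ∷ B ∷ y ++ A ∷ B ∷ z →
    map e (word w') ≡ x ++ y ++ z →
    _≃S_ H w w'
lemma3p2 H hS (nanoword _ p _ tw) (nanoword n p′ w′ tw′) A B x y z e A≢B |B|≡τ|A| e-inj p∘e≡p′ e≢A e≢B
         refl refl e[w′]≡xyz
  with map-++-++⁻ e w′ x y z e[w′]≡xyz
... | x′ , y′ , z′ , refl , refl , refl , refl = begin
  nanoword _ p _ tw                    ≈⟨ standard-form p′ A≢B e-inj p∘e≡p′ e≢A e≢B ⟨
  W₀                                   ≈⟨ W₀≃W₇ ⟩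
  W₇                                   ≈⟨ ≡-word fill-t₇ ⟩
  nanoword n p′ (x′ ++ y′ ++ z′) tw′   ∎
  where
  open Moves H
  open SetoidReasoning (setoid (Step H))
  open Chain p′ |B|≡τ|A| (proj₂ (hS (p B))) x′ y′ z′
             (subst (λ l → Gauss (x′ ++ y′ ++ l)) (sym (++-identityʳ z′)) tw′)
  fill-t₇ : fill t₇ ≡ x′ ++ y′ ++ z′
  fill-t₇ = cong₂ _++_ (map-id x′) (cong₂ _++_ (map-id y′) (trans (++-identityʳ _) (map-id z′)))
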